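{- Let $S$ be a numerical semigroup with minimal set of generators $a_1<a_2<\cdots<a_n$, where $n\geq 2$ (so $a_1=m(S)$), and let $a$ be an element of the minimal set of generators of $\operatorname{MED}(S)$. Then there exist non-negative integers $k_2,\dots,k_n$ such that $$a=\sum_{i=2}^n k_i a_i-(K-1)\,m(S), \qquad\text{where } K=\sum_{i=2}^n k_i \leq \frac{c(S)}{a_2-m(S)}.$$
   Context: A numerical semigroup is an additive submonoid $S \subseteq \mathbb{Z}_{\geq 0}$ with $\mathbb{Z}_{\geq 0}\setminus S$ finite; it has a unique minimal generating set. $m(S)$ is the smallest nonzero element of $S$; $c(S)$ (the conductor) is the smallest integer $c$ with $c+\mathbb{Z}_{\geq 0}\subseteq S$. $S$ is MED (maximal embedding dimension) if the size of its minimal generating set equals $m(S)$. $\operatorname{MED}(S)$ denotes the smallest (for inclusion) MED numerical semigroup $T\supseteq S$ with $m(T)=m(S)$ (it exists). -}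

module Defs where

open import Level using (0ℓ)
open import Data.Nat using (ℕ; zero; suc; _+_; _≤_; _<_)
open import Data.Fin using (Fin; zero; suc)
open import Data.Product using (Σ; _×_; ∃; _,_)
open import Relation.Nullary using (¬_)
open import Relation.Binary.PropositionalEquality using (_≡_; _≢_)
open import Function.Definitions using (Injective)

SubsetNat : Set₁
SubsetNat = ℕ → Set

_⊆ℕ_ : SubsetNat → SubsetNat → Set
A ⊆ℕ B = ∀ x → A x → B x

record IsNumericalSemigroup (S : SubsetNat) : Set where
  field
    has-zero  : S 0
    closed    : ∀ x y → S x → S y → S (x + y)
    cofinite  : ∃ λ c → ∀ x → c ≤ x → S x

data Gen (G : SubsetNat) : ℕ → Set where
  gen-zero : Gen G 0
  gen-add  : ∀ {g x} → G g → Gen G x → Gen G (g + x)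

Generates : SubsetNat → SubsetNat → Set
Generates G S = ∀ x → (S x → Gen G x) × (Gen G x → S x)

IsMinimalGeneratingSet : SubsetNat → SubsetNat → Set₁
IsMinimalGeneratingSet G S =
  Generates G S ×
  ((G' : SubsetNat) → G' ⊆ℕ G → Generates G' S → G ⊆ℕ G')

Image : ∀ {n} → (Fin n → ℕ) → SubsetNat
Image {n} f x = Σ (Fin n) λ i → f i ≡ x

IsMultiplicity : SubsetNat → ℕ → Set
IsMultiplicity S m = (m ≢ 0) × S m × (∀ x → S x → x ≢ 0 → m ≤ x)

IsConductor : SubsetNat → ℕ → Set
IsConductor S c = (∀ x → c ≤ x → S x) × (∀ d → (∀ x → d ≤ x → S x) → c ≤ d)

-- Maximal embedding dimension: the minimal generating set has exactly m(S)
-- elements (listed without repetition by an injective family Fin m → ℕ).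
IsMED : SubsetNat → Set₁
IsMED S = ∃ λ m → IsMultiplicity S m ×
          Σ (Fin m → ℕ) λ g → Injective _≡_ _≡_ g × IsMinimalGeneratingSet (Image g) S

IsMEDClosure : SubsetNat → ℕ → SubsetNat → Set₁
IsMEDClosure S m T =
  IsNumericalSemigroup T × IsMED T × S ⊆ℕ T × IsMultiplicity T m ×
  ((T' : SubsetNat) → IsNumericalSemigroup T' → IsMED T' → S ⊆ℕ T' →
      IsMultiplicity T' m → T ⊆ℕ T')

ΣFin : (n : ℕ) → (Fin n → ℕ) → ℕ
ΣFin zero    f = 0
ΣFin (suc n) f = f zero + ΣFin n (λ i → f (suc i))

StrictlyIncreasing : ∀ {n} → (Fin n → ℕ) → Set
StrictlyIncreasing {n} a = ∀ (i j : Fin n) → Data.Fin._<_ i j → a i < a j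

{-# OPTIONS --safe #-}
module Submission where

-- Write m = a₁ and dᵢ = aᵢ − m.  The set U = {0} ∪ (m + ⟨m, d₂, …, dₙ⟩) contains S, has
-- multiplicity m and is closed under (y, z) ↦ y + z − m for nonzero y, z; for a numerical
-- semigroup of multiplicity m this closure property is equivalent to being MED (the least
-- nonzero elements of the m residue classes then form a minimal generating set).  Hence
-- MED(S) ⊆ U, and a minimal generator x of MED(S) is m + e with e ∈ ⟨m, d₂, …, dₙ⟩.  The
-- generator m cannot occur in e: MED(S) is itself closed under y + z − m, so m + e′ ∈ MED(S)
-- and x = m + (m + e′) would be decomposable.  Thus e = Σ kᵢ dᵢ, i.e.
-- x = Σ kᵢ aᵢ − (K − 1) m.  Finally e ≤ c(S), since otherwise e ∈ S and x = m + e would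
-- again be decomposable, while e ≥ K (a₂ − m) because every dᵢ ≥ d₂.

open import Defs
open import Data.Empty using (⊥-elim)
open import Data.Fin using (Fin; zero; suc; toℕ)
import Data.Fin.Properties as Fin
open import Data.Integer using (ℤ; +_) renaming (_+_ to _+ℤ_; _-_ to _-ℤ_; _*_ to _*ℤ_)
import Data.Integer.Properties as ℤ
import Data.Integer.Tactic.RingSolver as ℤ-Solver
open import Data.Nat
  using (ℕ; zero; suc; _+_; _*_; _∸_; _≤_; _<_; _≟_; _≤?_; z≤n; z<s; s<s; s<s⁻¹; NonZero; ≢-nonZero; _%_; _/_)
open import Data.Nat.DivMod
  using (_mod_; m≡m%n+[m/n]*n; /-monoˡ-≤; m%n<n; [m+kn]%n≡m%n; m<n⇒m%n≡m; m≤n⇒[n∸m]%m≡n%m)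
open import Data.Nat.Induction using (<-rec)
open import Data.Nat.Properties
open import Algebra.Properties.CommutativeSemigroup +-commutativeSemigroup using (interchange; x∙yz≈y∙xz)
import Data.Nat.Tactic.RingSolver as ℕ-Solver
open import Data.Product using (Σ; _×_; ∃; _,_; proj₁; proj₂)
open import Data.Sum using (_⊎_; inj₁; inj₂)
open import Data.Vec.Functional using (updateAt)
open import Function using (_∘_)
open import Function.Definitions using (Injective)
open import Relation.Binary.Definitions using (tri<; tri≈; tri>)
open import Relation.Binary.PropositionalEquality
open import Relation.Nullary using (¬_; Dec; yes; no)
open import Relation.Nullary.Decidable using (map′; _×-dec_; ¬?)
open import Relation.Unary using (Decidable)

Irreducible : SubsetNat → ℕ → Set
Irreducible T x = ∀ {y z} → T y → T z → y ≢ 0 → z ≢ 0 → x ≢ y + z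

MEDClosed : SubsetNat → ℕ → Set
MEDClosed T m = ∀ {y z} → T y → T z → y ≢ 0 → z ≢ 0 → T (y + z ∸ m)

_without_ : SubsetNat → ℕ → SubsetNat
(G without x) w = G w × w ≢ x

Gen-mono : ∀ {G H : SubsetNat} → G ⊆ℕ H → ∀ {x} → Gen G x → Gen H x
Gen-mono G⊆H gen-zero = gen-zero
Gen-mono G⊆H (gen-add Gg rest) = gen-add (G⊆H _ Gg) (Gen-mono G⊆H rest)

Gen-+ : ∀ {G : SubsetNat} {x y} → Gen G x → Gen G y → Gen G (x + y)
Gen-+ gen-zero gy = gy
Gen-+ {G} {y = y} (gen-add {g} {x} Gg gx) gy =
  subst (Gen G) (sym (+-assoc g x y)) (gen-add Gg (Gen-+ gx gy))

Gen-singleton : ∀ {G : SubsetNat} {x} → G x → Gen G x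
Gen-singleton {G} {x} Gx = subst (Gen G) (+-identityʳ x) (gen-add Gx gen-zero)

Gen-below : ∀ {G : SubsetNat} {x w} → Gen G w → w < x → Gen (G without x) w
Gen-below gen-zero _ = gen-zero
Gen-below (gen-add {g} {r} Gg rest) g+r<x =
  gen-add (Gg , <⇒≢ (≤-<-trans (m≤m+n g r) g+r<x)) (Gen-below rest (≤-<-trans (m≤n+m r g) g+r<x))

Gen-dec : ∀ {n} (f : Fin n → ℕ) → (∀ i → f i ≢ 0) → Decidable (Gen (Image f))
Gen-dec {n} f f≢0 = <-rec _ step
  where
  LastSummand : ℕ → Fin n → Set
  LastSummand w i = f i ≤ w × Gen (Image f) (w ∸ f i)

  last-summand : ∀ {w} → w ≢ 0 → Gen (Image f) w → ∃ (LastSummand w)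
  last-summand w≢0 gen-zero = ⊥-elim (w≢0 refl)
  last-summand _ (gen-add {x = r} (i , refl) rest) =
    i , m≤m+n (f i) r , subst (Gen (Image f)) (sym (m+n∸m≡n (f i) r)) rest

  step : ∀ w → (∀ {v} → v < w → Dec (Gen (Image f) v)) → Dec (Gen (Image f) w)
  step zero _ = yes gen-zero
  step w@(suc _) rec = map′ from (last-summand λ ()) (Fin.any? last-summand?)
    where
    last-summand? : ∀ i → Dec (LastSummand w i)
    last-summand? i with f i ≤? w
    ... | no fi≰w = no (fi≰w ∘ proj₁)
    ... | yes fi≤w = map′ (fi≤w ,_) proj₂ (rec (∸-monoʳ-< (n≢0⇒n>0 (f≢0 i)) fi≤w))

    from : ∃ (LastSummand w) → Gen (Image f) w
    from (i , fi≤w , rest) = subst (Gen (Image f)) (m+[n∸m]≡n fi≤w) (gen-add (i , refl) rest)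

Least : (ℕ → Set) → ℕ → Set
Least P w = P w × (∀ {v} → v < w → ¬ P v)

least-witness : ∀ {P : ℕ → Set} → Decidable P → ∀ {n} → P n → ∃ (Least P)
least-witness {P} P? {n} = <-rec (λ n → P n → ∃ (Least P)) search n
  where
  search : ∀ n → (∀ {v} → v < n → P v → ∃ (Least P)) → P n → ∃ (Least P)
  search n rec Pn with anyUpTo? P? n
  ... | yes (v , v<n , Pv) = rec v<n Pv
  ... | no none = n , Pn , λ v<n Pv → none (_ , v<n , Pv)

a≤b∧a%m≡b%m⇒b≡a+q*m : ∀ {m a b} .{{_ : NonZero m}} → a ≤ b → a % m ≡ b % m →
                       ∃ λ q → b ≡ a + q * m
a≤b∧a%m≡b%m⇒b≡a+q*m {m} {a} {b} a≤b a≡b = q , (begin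
  b                           ≡⟨ m≡m%n+[m/n]*n b m ⟩
  b % m + b / m * m           ≡⟨ cong₂ (λ r s → r + s * m) (sym a≡b) (sym (m+[n∸m]≡n (/-monoˡ-≤ m a≤b))) ⟩
  a % m + (a / m + q) * m     ≡⟨ cong (_+_ (a % m)) (*-distribʳ-+ m (a / m) q) ⟩
  a % m + (a / m * m + q * m) ≡⟨ +-assoc (a % m) _ _ ⟨
  a % m + a / m * m + q * m   ≡⟨ cong (_+ q * m) (m≡m%n+[m/n]*n a m) ⟨
  a + q * m                   ∎)
  where
  open ≡-Reasoning
  q = b / m ∸ a / m

mod-≡⇒%-≡ : ∀ {m a b} .{{_ : NonZero m}} → a mod m ≡ b mod m → a % m ≡ b % m
mod-≡⇒%-≡ {m} {a} {b} eq =
  trans (sym (Fin.toℕ-fromℕ< (m%n<n a m))) (trans (cong toℕ eq) (Fin.toℕ-fromℕ< (m%n<n b m)))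

multiplicity-unique : ∀ {S : SubsetNat} {m m′} → IsMultiplicity S m → IsMultiplicity S m′ → m ≡ m′
multiplicity-unique (m≢0 , Sm , m-least) (m′≢0 , Sm′ , m′-least) =
  ≤-antisym (m-least _ Sm′ m′≢0) (m′-least _ Sm m≢0)

module MinimalGeneratingSet {G T : SubsetNat} (mgs : IsMinimalGeneratingSet G T) where

  ∈⇒Gen : ∀ {x} → T x → Gen G x
  ∈⇒Gen = proj₁ (proj₁ mgs _)

  Gen⇒∈ : ∀ {x} → Gen G x → T x
  Gen⇒∈ = proj₂ (proj₁ mgs _)

  generator∈ : ∀ {x} → G x → T x
  generator∈ = Gen⇒∈ ∘ Gen-singleton

  ¬Gen-without : ∀ {x} → G x → ¬ Gen (G without x) x
  ¬Gen-without {x} Gx gx = proj₂ (proj₂ mgs (G without x) (λ _ → proj₁) generates x Gx) refl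
    where
    replace : ∀ {w} → Gen G w → Gen (G without x) w
    replace gen-zero = gen-zero
    replace (gen-add {g} Gg rest) with g ≟ x
    ... | yes refl = Gen-+ gx (replace rest)
    ... | no g≢x = gen-add (Gg , g≢x) (replace rest)

    generates : Generates (G without x) T
    generates w = replace ∘ ∈⇒Gen , Gen⇒∈ ∘ Gen-mono (λ _ → proj₁)

  generator≢0 : ∀ {x} → G x → x ≢ 0
  generator≢0 Gx refl = ¬Gen-without Gx gen-zero

  generator-irreducible : ∀ {x} → G x → Irreducible T x
  generator-irreducible {x} Gx {y} {z} Ty Tz y≢0 z≢0 x≡y+z =
    ¬Gen-without Gx (subst (Gen (G without x)) (sym x≡y+z)
      (Gen-+ (Gen-below (∈⇒Gen Ty) y<x) (Gen-below (∈⇒Gen Tz) z<x)))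
    where
    y<x : y < x
    y<x = subst (y <_) (sym x≡y+z) (m<m+n y (n≢0⇒n>0 z≢0))
    z<x : z < x
    z<x = subst (z <_) (sym x≡y+z) (m<n+m z (n≢0⇒n>0 y≢0))

irreducibles-minimal : ∀ {G T : SubsetNat} → Generates G T → (∀ {x} → G x → x ≢ 0) →
                       (∀ {x} → G x → Irreducible T x) → IsMinimalGeneratingSet G T
irreducibles-minimal {G} {T} G-gen G≢0 G-irr = G-gen , minimal
  where
  minimal : (G′ : SubsetNat) → G′ ⊆ℕ G → Generates G′ T → G ⊆ℕ G′
  minimal G′ G′⊆G G′-gen x Gx = first-summand Gx (proj₁ (G′-gen x) (proj₂ (G-gen x) (Gen-singleton Gx)))
    where
    first-summand : ∀ {w} → G w → Gen G′ w → G′ w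
    first-summand Gw gen-zero = ⊥-elim (G≢0 Gw refl)
    first-summand Gw (gen-add {g} {r} G′g rest) with r ≟ 0
    ... | yes refl = subst G′ (sym (+-identityʳ g)) G′g
    ... | no r≢0 = ⊥-elim (G-irr Gw Tg (proj₂ (G′-gen r) rest) (G≢0 Gg) r≢0 refl)
      where
      Gg = G′⊆G g G′g
      Tg = proj₂ (G-gen g) (Gen-singleton Gg)

module MEDSemigroup {T : SubsetNat} (T-ns : IsNumericalSemigroup T) {m} (T-mult : IsMultiplicity T m)
                    {g : Fin m → ℕ} (g-injective : Injective _≡_ _≡_ g)
                    (g-mgs : IsMinimalGeneratingSet (Image g) T) where
  open IsNumericalSemigroup T-ns
  open MinimalGeneratingSet g-mgs

  private instance
    m-nonZero : NonZero m
    m-nonZero = ≢-nonZero (proj₁ T-mult)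

  multiple∈ : ∀ q → T (q * m)
  multiple∈ zero = has-zero
  multiple∈ (suc q) = closed m (q * m) (proj₁ (proj₂ T-mult)) (multiple∈ q)

  generator-least-in-class : ∀ {u i} → T u → u ≢ 0 → u % m ≡ g i % m → ¬ u < g i
  generator-least-in-class {u} {i} Tu u≢0 u≡g u<g with a≤b∧a%m≡b%m⇒b≡a+q*m (<⇒≤ u<g) u≡g
  ... | zero , g≡u+0 = <⇒≢ u<g (sym (trans g≡u+0 (+-identityʳ u)))
  ... | suc q , g≡u+qm =
    generator-irreducible (i , refl) Tu (multiple∈ (suc q)) u≢0 (proj₁ T-mult ∘ m+n≡0⇒m≡0 m) g≡u+qm

  generator-residues-injective : ∀ {i j} → g i % m ≡ g j % m → i ≡ j
  generator-residues-injective {i} {j} gi≡gj with <-cmp (g i) (g j)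
  ... | tri< gi<gj _ _ =
    ⊥-elim (generator-least-in-class (generator∈ (i , refl)) (generator≢0 (i , refl)) gi≡gj gi<gj)
  ... | tri≈ _ gi≡gj′ _ = g-injective gi≡gj′
  ... | tri> _ _ gj<gi =
    ⊥-elim (generator-least-in-class (generator∈ (j , refl)) (generator≢0 (j , refl)) (sym gi≡gj) gj<gi)

  residues : ℕ → Fin (suc m) → Fin m
  residues v zero = v mod m
  residues v (suc i) = g i mod m

  -- Pigeonhole: the m generators lie in m distinct residue classes.
  generator-in-class : ∀ v → ∃ λ j → g j % m ≡ v % m
  generator-in-class v with Fin.pigeonhole (n<1+n m) (residues v)
  ... | _ , zero , () , _
  ... | zero , suc j , _ , v≡gj = j , sym (mod-≡⇒%-≡ v≡gj)
  ... | suc i , suc j , i<j , gi≡gj =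
    ⊥-elim (Fin.<⇒≢ (s<s⁻¹ i<j) (generator-residues-injective (mod-≡⇒%-≡ gi≡gj)))

  generator⊎∸m∈ : ∀ {v} → T v → v ≢ 0 → Image g v ⊎ T (v ∸ m)
  generator⊎∸m∈ {v} Tv v≢0 with generator-in-class v
  ... | j , gj≡v with <-cmp v (g j)
  ...   | tri< v<gj _ _ = ⊥-elim (generator-least-in-class Tv v≢0 (sym gj≡v) v<gj)
  ...   | tri≈ _ v≡gj _ = inj₁ (j , sym v≡gj)
  ...   | tri> _ _ gj<v with a≤b∧a%m≡b%m⇒b≡a+q*m (<⇒≤ gj<v) gj≡v
  ...     | zero , v≡gj+0 = ⊥-elim (>⇒≢ gj<v (trans v≡gj+0 (+-identityʳ (g j))))
  ...     | suc q , v≡gj+qm = inj₂ (subst T (sym v∸m≡gj+qm) (closed _ _ (generator∈ (j , refl)) (multiple∈ q)))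
    where
    v∸m≡gj+qm : v ∸ m ≡ g j + q * m
    v∸m≡gj+qm = begin
      v ∸ m                      ≡⟨ cong (_∸ m) v≡gj+qm ⟩
      g j + (m + q * m) ∸ m      ≡⟨ cong (_∸ m) (x∙yz≈y∙xz (g j) m (q * m)) ⟩
      m + (g j + q * m) ∸ m      ≡⟨ m+n∸m≡n m _ ⟩
      g j + q * m                ∎
      where open ≡-Reasoning

  closed-MED : MEDClosed T m
  closed-MED {y} {z} Ty Tz y≢0 z≢0 with generator⊎∸m∈ (closed y z Ty Tz) (y≢0 ∘ m+n≡0⇒m≡0 y)
  ... | inj₁ y+z∈G = ⊥-elim (generator-irreducible y+z∈G Ty Tz y≢0 z≢0 refl)
  ... | inj₂ y+z∸m∈T = y+z∸m∈T

IsMED⇒MEDClosed : ∀ {T : SubsetNat} {m} → IsNumericalSemigroup T → IsMultiplicity T m → IsMED T → MEDClosed T m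
IsMED⇒MEDClosed T-ns T-mult (m′ , T-mult′ , g , g-injective , g-mgs)
  with refl ← multiplicity-unique T-mult′ T-mult = MEDSemigroup.closed-MED T-ns T-mult g-injective g-mgs

module MEDClosedSemigroup {U : SubsetNat} (U-ns : IsNumericalSemigroup U) {m} (U-mult : IsMultiplicity U m)
                          (U? : Decidable U) (U-med : MEDClosed U m) where
  open IsNumericalSemigroup U-ns

  private instance
    m-nonZero : NonZero m
    m-nonZero = ≢-nonZero (proj₁ U-mult)

  m-least : ∀ {x} → U x → x ≢ 0 → m ≤ x
  m-least = proj₂ (proj₂ U-mult) _

  InClass : Fin m → ℕ → Set
  InClass r w = U w × w ≢ 0 × w % m ≡ toℕ r

  InClass? : ∀ r → Decidable (InClass r)
  InClass? r w = U? w ×-dec ¬? (w ≟ 0) ×-dec (w % m ≟ toℕ r)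

  InClass-mod : ∀ {w} → U w → w ≢ 0 → InClass (w mod m) w
  InClass-mod Uw w≢0 = Uw , w≢0 , sym (Fin.toℕ-fromℕ< (m%n<n _ m))

  InClass-inhabited : ∀ r → ∃ (InClass r)
  InClass-inhabited r = w , proj₂ cofinite w (<⇒≤ c<w) , m<n⇒n≢0 c<w , w%m≡r
    where
    c = proj₁ cofinite
    w = toℕ r + suc c * m
    c<w : c < w
    c<w = ≤-trans (m≤m*n (suc c) m) (m≤n+m _ (toℕ r))
    w%m≡r : w % m ≡ toℕ r
    w%m≡r = trans ([m+kn]%n≡m%n (toℕ r) (suc c) m) (m<n⇒m%n≡m (Fin.toℕ<n r))

  least-in-class : ∀ r → ∃ (Least (InClass r))
  least-in-class r = least-witness (InClass? r) (proj₂ (InClass-inhabited r))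

  -- The Apéry set of U with respect to m, except that the class of 0 is represented by m.
  leastIn : Fin m → ℕ
  leastIn r = proj₁ (least-in-class r)

  leastIn∈ : ∀ r → U (leastIn r)
  leastIn∈ r = proj₁ (proj₁ (proj₂ (least-in-class r)))

  leastIn≢0 : ∀ r → leastIn r ≢ 0
  leastIn≢0 r = proj₁ (proj₂ (proj₁ (proj₂ (least-in-class r))))

  leastIn-% : ∀ r → leastIn r % m ≡ toℕ r
  leastIn-% r = proj₂ (proj₂ (proj₁ (proj₂ (least-in-class r))))

  leastIn-≤ : ∀ r {w} → InClass r w → leastIn r ≤ w
  leastIn-≤ r w∈r = ≮⇒≥ λ w<l → proj₂ (proj₂ (least-in-class r)) w<l w∈r

  leastIn-injective : Injective _≡_ _≡_ leastIn
  leastIn-injective {r} {s} lr≡ls = Fin.toℕ-injective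
    (trans (sym (leastIn-% r)) (trans (cong (_% m) lr≡ls) (leastIn-% s)))

  m∈leastIn : Image leastIn m
  m∈leastIn = r , ≤-antisym (leastIn-≤ r (InClass-mod (proj₁ (proj₂ U-mult)) (proj₁ U-mult)))
                            (m-least (leastIn∈ r) (leastIn≢0 r))
    where r = m mod m

  Gen-multiple : ∀ q → Gen (Image leastIn) (q * m)
  Gen-multiple zero = gen-zero
  Gen-multiple (suc q) = gen-add m∈leastIn (Gen-multiple q)

  InClass⇒Gen : ∀ {r w} → InClass r w → Gen (Image leastIn) w
  InClass⇒Gen {r} w∈r@(_ , _ , w≡r)
    with a≤b∧a%m≡b%m⇒b≡a+q*m (leastIn-≤ r w∈r) (trans (leastIn-% r) (sym w≡r))
  ... | q , w≡l+qm = subst (Gen (Image leastIn)) (sym w≡l+qm) (gen-add (r , refl) (Gen-multiple q))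

  ∈⇒Gen : ∀ {w} → U w → Gen (Image leastIn) w
  ∈⇒Gen {w} Uw with w ≟ 0
  ... | yes refl = gen-zero
  ... | no w≢0 = InClass⇒Gen (InClass-mod Uw w≢0)

  Gen⇒∈ : ∀ {w} → Gen (Image leastIn) w → U w
  Gen⇒∈ gen-zero = has-zero
  Gen⇒∈ (gen-add (r , refl) rest) = closed _ _ (leastIn∈ r) (Gen⇒∈ rest)

  -- If leastIn r = y + z, then y + z − m is a smaller element of the same class.
  leastIn-irreducible : ∀ r → Irreducible U (leastIn r)
  leastIn-irreducible r {y} {z} Uy Uz y≢0 z≢0 l≡y+z = <⇒≱ v<l (leastIn-≤ r v∈r)
    where
    m≤y = m-least Uy y≢0
    m≤y+z = ≤-trans m≤y (m≤m+n y z)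
    v = y + z ∸ m
    v<l : v < leastIn r
    v<l = subst (v <_) (sym l≡y+z) (∸-monoʳ-< {o = 0} (n≢0⇒n>0 (proj₁ U-mult)) m≤y+z)
    v≢0 : v ≢ 0
    v≢0 v≡0 = z≢0 (m+n≡0⇒n≡0 (y ∸ m) (trans (sym (+-∸-comm z m≤y)) v≡0))
    v∈r : InClass r v
    v∈r = U-med Uy Uz y≢0 z≢0 , v≢0 ,
          trans (m≤n⇒[n∸m]%m≡n%m m≤y+z) (trans (cong (_% m) (sym l≡y+z)) (leastIn-% r))

  isMED : IsMED U
  isMED = m , U-mult , leastIn , leastIn-injective ,
          irreducibles-minimal (λ _ → ∈⇒Gen , Gen⇒∈)
                               (λ { (r , refl) → leastIn≢0 r })
                               (λ { (r , refl) → leastIn-irreducible r })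

ΣFin-cong : ∀ n {f g : Fin n → ℕ} → (∀ i → f i ≡ g i) → ΣFin n f ≡ ΣFin n g
ΣFin-cong zero f≡g = refl
ΣFin-cong (suc n) f≡g = cong₂ _+_ (f≡g zero) (ΣFin-cong n (f≡g ∘ suc))

ΣFin-0 : ∀ n → ΣFin n (λ _ → 0) ≡ 0
ΣFin-0 zero = refl
ΣFin-0 (suc n) = ΣFin-0 n

ΣFin-+ : ∀ n (f g : Fin n → ℕ) → ΣFin n (λ i → f i + g i) ≡ ΣFin n f + ΣFin n g
ΣFin-+ zero f g = refl
ΣFin-+ (suc n) f g =
  trans (cong (_+_ (f zero + g zero)) (ΣFin-+ n (f ∘ suc) (g ∘ suc)))
        (interchange (f zero) (g zero) (ΣFin n (f ∘ suc)) (ΣFin n (g ∘ suc)))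

ΣFin-*ʳ : ∀ n (f : Fin n → ℕ) c → ΣFin n (λ i → f i * c) ≡ ΣFin n f * c
ΣFin-*ʳ zero f c = refl
ΣFin-*ʳ (suc n) f c =
  trans (cong (_+_ (f zero * c)) (ΣFin-*ʳ n (f ∘ suc) c)) (sym (*-distribʳ-+ c (f zero) _))

ΣFin-updateAt-suc : ∀ n (k d : Fin n → ℕ) j →
                    ΣFin n (λ i → updateAt k j suc i * d i) ≡ d j + ΣFin n (λ i → k i * d i)
ΣFin-updateAt-suc (suc n) k d zero = +-assoc (d zero) (k zero * d zero) _
ΣFin-updateAt-suc (suc n) k d (suc j) =
  trans (cong (_+_ (k zero * d zero)) (ΣFin-updateAt-suc n (k ∘ suc) (d ∘ suc) j))
        (x∙yz≈y∙xz (k zero * d zero) (d (suc j)) _)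

ΣFin-*-lowerBound : ∀ n (k d : Fin n → ℕ) {b} → (∀ j → b ≤ d j) →
                    ΣFin n k * b ≤ ΣFin n (λ j → k j * d j)
ΣFin-*-lowerBound zero k d b≤d = z≤n
ΣFin-*-lowerBound (suc n) k d {b} b≤d = begin
  (k zero + ΣFin n (k ∘ suc)) * b
    ≡⟨ *-distribʳ-+ b (k zero) _ ⟩
  k zero * b + ΣFin n (k ∘ suc) * b
    ≤⟨ +-mono-≤ (*-monoʳ-≤ (k zero) (b≤d zero)) (ΣFin-*-lowerBound n (k ∘ suc) (d ∘ suc) (b≤d ∘ suc)) ⟩
  k zero * d zero + ΣFin n (λ j → k (suc j) * d (suc j))
    ∎
  where open ≤-Reasoning

[m+a]+[m+b]∸m≡m+[a+b] : ∀ m a b → (m + a) + (m + b) ∸ m ≡ m + (a + b)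
[m+a]+[m+b]∸m≡m+[a+b] m a b = trans (cong (_∸ m) (rearrange m a b)) (m+n∸n≡m (m + (a + b)) m)
  where
  rearrange : ∀ m a b → (m + a) + (m + b) ≡ (m + (a + b)) + m
  rearrange = ℕ-Solver.solve-∀

module ShiftedSemigroup (m : ℕ) (m≢0 : m ≢ 0) {n} (d : Fin n → ℕ) (d≢0 : ∀ j → d j ≢ 0) where

  generators : Fin (suc n) → ℕ
  generators zero = m
  generators (suc j) = d j

  E : SubsetNat
  E = Gen (Image generators)

  U : SubsetNat
  U y = y ≡ 0 ⊎ ∃ λ e → E e × y ≡ m + e

  U-closed : ∀ x y → U x → U y → U (x + y)
  U-closed _ _ (inj₁ refl) Uy = Uy
  U-closed x _ Ux (inj₁ refl) = subst U (sym (+-identityʳ x)) Ux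
  U-closed _ _ (inj₂ (e₁ , Ee₁ , refl)) (inj₂ (e₂ , Ee₂ , refl)) =
    inj₂ (m + (e₁ + e₂) , gen-add (zero , refl) (Gen-+ Ee₁ Ee₂) , rearrange m e₁ e₂)
    where
    rearrange : ∀ m a b → (m + a) + (m + b) ≡ m + (m + (a + b))
    rearrange = ℕ-Solver.solve-∀

  U-MEDClosed : MEDClosed U m
  U-MEDClosed (inj₁ refl) _ y≢0 _ = ⊥-elim (y≢0 refl)
  U-MEDClosed _ (inj₁ refl) _ z≢0 = ⊥-elim (z≢0 refl)
  U-MEDClosed (inj₂ (e₁ , Ee₁ , refl)) (inj₂ (e₂ , Ee₂ , refl)) _ _ =
    inj₂ (e₁ + e₂ , Gen-+ Ee₁ Ee₂ , [m+a]+[m+b]∸m≡m+[a+b] m e₁ e₂)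

  U-multiplicity : IsMultiplicity U m
  U-multiplicity = m≢0 , inj₂ (0 , gen-zero , sym (+-identityʳ m)) , m-least
    where
    m-least : ∀ x → U x → x ≢ 0 → m ≤ x
    m-least _ (inj₁ refl) x≢0 = ⊥-elim (x≢0 refl)
    m-least _ (inj₂ (e , _ , refl)) _ = m≤m+n m e

  U? : Decidable U
  U? w with w ≟ 0 | m ≤? w
  ... | yes w≡0 | _ = yes (inj₁ w≡0)
  ... | no w≢0 | no m≰w = no λ { (inj₁ w≡0) → w≢0 w≡0 ; (inj₂ (e , _ , refl)) → m≰w (m≤m+n m e) }
  ... | no w≢0 | yes m≤w = map′ to from (Gen-dec generators generators≢0 (w ∸ m))
    where
    generators≢0 : ∀ i → generators i ≢ 0
    generators≢0 zero = m≢0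
    generators≢0 (suc j) = d≢0 j
    to : E (w ∸ m) → U w
    to E[w∸m] = inj₂ (w ∸ m , E[w∸m] , sym (m+[n∸m]≡n m≤w))
    from : U w → E (w ∸ m)
    from (inj₁ w≡0) = ⊥-elim (w≢0 w≡0)
    from (inj₂ (e , Ee , refl)) = subst E (sym (m+n∸m≡n m e)) Ee

  E-coefficients : ∀ {e} → E e →
                   (∃ λ e′ → E e′ × e ≡ m + e′) ⊎ (∃ λ (k : Fin n → ℕ) → e ≡ ΣFin n (λ j → k j * d j))
  E-coefficients gen-zero = inj₂ ((λ _ → 0) , sym (ΣFin-0 n))
  E-coefficients (gen-add (zero , refl) rest) = inj₁ (_ , rest , refl)
  E-coefficients (gen-add (suc j , refl) rest) with E-coefficients rest
  ... | inj₁ (e′ , Ee′ , refl) = inj₁ (d j + e′ , gen-add (suc j , refl) Ee′ , x∙yz≈y∙xz (d j) m e′)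
  ... | inj₂ (k , refl) = inj₂ (updateAt k j suc , sym (ΣFin-updateAt-suc n k d j))

+x≡+A-[+K-1]*+m : ∀ {x m e K A} → x ≡ m + e → A ≡ K * m + e → + x ≡ + A -ℤ (+ K -ℤ + 1) *ℤ + m
+x≡+A-[+K-1]*+m {m = m} {e} {K} refl refl = begin
  + (m + e)                                ≡⟨ ℤ.pos-+ m e ⟩
  + m +ℤ + e                               ≡⟨ identity (+ K) (+ m) (+ e) ⟩
  + K *ℤ + m +ℤ + e -ℤ (+ K -ℤ + 1) *ℤ + m ≡⟨ cong (λ t → t +ℤ + e -ℤ (+ K -ℤ + 1) *ℤ + m) (ℤ.pos-* K m) ⟨
  + (K * m) +ℤ + e -ℤ (+ K -ℤ + 1) *ℤ + m  ≡⟨ cong (λ t → t -ℤ (+ K -ℤ + 1) *ℤ + m) (ℤ.pos-+ (K * m) e) ⟨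
  + (K * m + e) -ℤ (+ K -ℤ + 1) *ℤ + m     ∎
  where
  open ≡-Reasoning
  identity : ∀ (K m e : ℤ) → m +ℤ e ≡ K *ℤ m +ℤ e -ℤ (K -ℤ + 1) *ℤ m
  identity = ℤ-Solver.solve-∀

module MEDClosureOf {k} {S : SubsetNat} {a : Fin (suc (suc k)) → ℕ} (S-ns : IsNumericalSemigroup S)
                   (a-increasing : StrictlyIncreasing a) (a-mgs : IsMinimalGeneratingSet (Image a) S) where
  open MinimalGeneratingSet a-mgs using () renaming (∈⇒Gen to S⇒Gen; generator∈ to a∈S; generator≢0 to a≢0)

  m : ℕ
  m = a zero

  m≢0 : m ≢ 0
  m≢0 = a≢0 (zero , refl)

  d : Fin (suc k) → ℕ
  d j = a (suc j) ∸ m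

  m<a : ∀ j → m < a (suc j)
  m<a j = a-increasing zero (suc j) z<s

  a≡m+d : ∀ j → a (suc j) ≡ m + d j
  a≡m+d j = sym (m+[n∸m]≡n (<⇒≤ (m<a j)))

  d≢0 : ∀ j → d j ≢ 0
  d≢0 j = n>0⇒n≢0 (m<n⇒0<n∸m (m<a j))

  d-least : ∀ j → d zero ≤ d j
  d-least zero = ≤-refl
  d-least (suc j) = ∸-monoˡ-≤ m (<⇒≤ (a-increasing (suc zero) (suc (suc j)) (s<s z<s)))

  open ShiftedSemigroup m m≢0 d d≢0 public

  a∈U : ∀ i → U (a i)
  a∈U zero = inj₂ (0 , gen-zero , sym (+-identityʳ m))
  a∈U (suc j) = inj₂ (d j , Gen-singleton (suc j , refl) , a≡m+d j)

  S⊆U : S ⊆ℕ U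
  S⊆U _ Ss = Gen⇒U (S⇒Gen Ss)
    where
    Gen⇒U : ∀ {w} → Gen (Image a) w → U w
    Gen⇒U gen-zero = inj₁ refl
    Gen⇒U (gen-add (i , refl) rest) = U-closed _ _ (a∈U i) (Gen⇒U rest)

  U-ns : IsNumericalSemigroup U
  U-ns = record
    { has-zero = inj₁ refl
    ; closed   = U-closed
    ; cofinite = proj₁ S-cofinite , λ x c≤x → S⊆U x (proj₂ S-cofinite x c≤x)
    }
    where S-cofinite = IsNumericalSemigroup.cofinite S-ns

  U-isMED : IsMED U
  U-isMED = MEDClosedSemigroup.isMED U-ns U-multiplicity U? U-MEDClosed

  a-weighted-sum : ∀ (kk : Fin (suc k) → ℕ) →
    ΣFin (suc k) (λ j → kk j * a (suc j)) ≡ ΣFin (suc k) kk * m + ΣFin (suc k) (λ j → kk j * d j)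
  a-weighted-sum kk = begin
    ΣFin (suc k) (λ j → kk j * a (suc j))
      ≡⟨ ΣFin-cong (suc k) (λ j → cong (kk j *_) (a≡m+d j)) ⟩
    ΣFin (suc k) (λ j → kk j * (m + d j))
      ≡⟨ ΣFin-cong (suc k) (λ j → *-distribˡ-+ (kk j) m (d j)) ⟩
    ΣFin (suc k) (λ j → kk j * m + kk j * d j)
      ≡⟨ ΣFin-+ (suc k) (λ j → kk j * m) (λ j → kk j * d j) ⟩
    ΣFin (suc k) (λ j → kk j * m) + ΣFin (suc k) (λ j → kk j * d j)
      ≡⟨ cong (_+ ΣFin (suc k) (λ j → kk j * d j)) (ΣFin-*ʳ (suc k) kk m) ⟩
    ΣFin (suc k) kk * m + ΣFin (suc k) (λ j → kk j * d j)
      ∎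
    where open ≡-Reasoning

  module MEDSuperset {T : SubsetNat} (T-ns : IsNumericalSemigroup T) (T-med : IsMED T) (S⊆T : S ⊆ℕ T)
                     (T-mult : IsMultiplicity T m) where
    open IsNumericalSemigroup T-ns

    m∈T : T m
    m∈T = proj₁ (proj₂ T-mult)

    m+E⊆T : ∀ {e} → E e → T (m + e)
    m+E⊆T gen-zero = subst T (sym (+-identityʳ m)) m∈T
    m+E⊆T (gen-add (zero , refl) rest) = closed m _ m∈T (m+E⊆T rest)
    m+E⊆T (gen-add {x = e} (suc j , refl) rest) =
      subst T (trans (cong (λ t → t + (m + e) ∸ m) (a≡m+d j)) ([m+a]+[m+b]∸m≡m+[a+b] m (d j) e))
        (IsMED⇒MEDClosed T-ns T-mult T-med (S⊆T _ (a∈S (suc j , refl))) (m+E⊆T rest)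
                         (a≢0 (suc j , refl)) (m≢0 ∘ m+n≡0⇒m≡0 m))

    module Generators {G : SubsetNat} (G-mgs : IsMinimalGeneratingSet G T) where
      open MinimalGeneratingSet G-mgs

      generator-form : T ⊆ℕ U → ∀ {x} → G x →
                       ∃ λ (kk : Fin (suc k) → ℕ) → x ≡ m + ΣFin (suc k) (λ j → kk j * d j)
      generator-form T⊆U {x} Gx with T⊆U x (generator∈ Gx)
      ... | inj₁ x≡0 = ⊥-elim (generator≢0 Gx x≡0)
      ... | inj₂ (e , Ee , x≡m+e) with E-coefficients Ee
      ...   | inj₁ (e′ , Ee′ , refl) =
        ⊥-elim (generator-irreducible Gx m∈T (m+E⊆T Ee′) m≢0 (m≢0 ∘ m+n≡0⇒m≡0 m) x≡m+e)
      ...   | inj₂ (kk , refl) = kk , x≡m+e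

      excess≤conductor : ∀ {c x e} → (∀ y → c ≤ y → S y) → G x → x ≡ m + e → e ≤ c
      excess≤conductor S-conductor Gx x≡m+e = ≮⇒≥ λ c<e →
        generator-irreducible Gx m∈T (S⊆T _ (S-conductor _ (<⇒≤ c<e))) m≢0 (m<n⇒n≢0 c<e) x≡m+e

mainTheorem6 : (k : ℕ) (S : SubsetNat) (a : Fin (suc (suc k)) → ℕ)
    → IsNumericalSemigroup S
    → StrictlyIncreasing a
    → IsMinimalGeneratingSet (Image a) S
    → (c : ℕ) → IsConductor S c
    → (T : SubsetNat) → IsMEDClosure S (a zero) T
    → (G : SubsetNat) → IsMinimalGeneratingSet G T
    → (x : ℕ) → G x
    → Σ (Fin (suc k) → ℕ) λ kk →
        (+ x ≡ (+ ΣFin (suc k) (λ j → kk j * a (suc j)))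
               -ℤ ((+ ΣFin (suc k) kk) -ℤ + 1) *ℤ + a zero)
        × (ΣFin (suc k) kk * (a (suc zero) ∸ a zero) ≤ c)
mainTheorem6 k S a S-ns a-increasing a-mgs c (S-conductor , _) T (T-ns , T-med , S⊆T , T-mult , T-least) G G-mgs x Gx =
  let kk , x≡m+e = generator-form T⊆U Gx in
  kk , +x≡+A-[+K-1]*+m {K = ΣFin (suc k) kk} x≡m+e (a-weighted-sum kk) ,
  ≤-trans (ΣFin-*-lowerBound (suc k) kk d d-least) (excess≤conductor S-conductor Gx x≡m+e)
  where
  open MEDClosureOf S-ns a-increasing a-mgs
  open MEDSuperset T-ns T-med S⊆T T-mult
  open Generators G-mgs

  T⊆U : T ⊆ℕ U
  T⊆U = T-least U U-ns U-isMED S⊆U U-multiplicity
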